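{- Let $A\ge 2$ and $B\ge 2$ be integers, let $k,m,\ell\ge 0$, and let $a_0,\ldots,a_k$, $c_0,\ldots,c_m$, $b_0,\ldots,b_\ell$ be positive integers. Let $$\alpha=[a_0,\ldots,a_k,A,c_0,\ldots,c_m,B,b_0,\ldots,b_\ell],\qquad \alpha'=[a_0,\ldots,a_k,A-1,1,c_m,\ldots,c_0,1,B-1,b_0,\ldots,b_\ell].$$ Denote by $\frac{p_i}{q_i}$, $\frac{r_i}{s_i}$, $\frac{u_i}{v_i}$ the $i$-th convergents of $[a_0,\ldots,a_k]$, $[b_0,\ldots,b_\ell]$, $[c_0,\ldots,c_m]$ respectively. Then $\mathcal{N}(\alpha')\ge\mathcal{N}(\alpha)$, and $$\mathcal{N}(\alpha')-\mathcal{N}(\alpha)=(u_{m-1}+v_m+v_{m-1})\bigl(p_kr_\ell(AB-A-B)+p_ks_\ell(A-1)+p_{k-1}r_\ell(B-1)+p_{k-1}s_\ell\bigr).$$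
   Context: For a finite continued fraction $[x_0,\ldots,x_n]$, its convergents $\frac{p_i}{q_i}=[x_0,\ldots,x_i]$ are given by the recursion $p_i=x_ip_{i-1}+p_{i-2}$, $q_i=x_iq_{i-1}+q_{i-2}$ with $p_{ -2}=0,p_{ -1}=1,q_{ -2}=1,q_{ -1}=0$ (the same conventions apply to $r_i,s_i$ and $u_i,v_i$). The numerator $\mathcal{N}$ of a finite continued fraction $[x_0,\ldots,x_n]$ is $p_n$ computed by this recursion, i.e. the upper-left entry of $\prod_{i=0}^n\begin{pmatrix}x_i&1\\1&0\end{pmatrix}$. -}

module Defs where

open import Data.Nat using (ℕ; _+_; _*_)
open import Data.List using (List; []; _∷_; _++_; reverse; foldl)
open import Data.Product using (_×_; _,_; proj₁; proj₂)

-- State of the convergent recursion after processing x_0..x_i: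
-- ((p_i , p_{i-1}) , (q_i , q_{i-1})).
-- Initial state is ((p_{-1}, p_{-2}), (q_{-1}, q_{-2})) = ((1,0),(0,1)).
ConvState : Set
ConvState = (ℕ × ℕ) × (ℕ × ℕ)

convStep : ConvState → ℕ → ConvState
convStep ((p , p') , (q , q')) x = ((x * p + p' , p) , (x * q + q' , q))

convInit : ConvState
convInit = ((1 , 0) , (0 , 1))

conv : List ℕ → ConvState
conv = foldl convStep convInit

pLast pPrev qLast qPrev : List ℕ → ℕ
pLast xs = proj₁ (proj₁ (conv xs))
pPrev xs = proj₂ (proj₁ (conv xs))
qLast xs = proj₁ (proj₂ (conv xs))
qPrev xs = proj₂ (proj₂ (conv xs))

𝒩 : List ℕ → ℕ
𝒩 = pLast

-- Writing M x for the matrix [[x, 1], [1, 0]], the state of the convergent recursion after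
-- [x₀, …, xₙ] is M x₀ ⋯ M xₙ, and reversing the list transposes the product. So 𝒩 α and 𝒩 α'
-- are the upper-left entries of P (M A · C) (M B · Q) and P (M (A-1) M 1 Cᵀ) (M 1 M (B-1) Q)
-- with P, C, Q the matrices of a, c, b; their difference is a polynomial identity in the
-- entries of P, C, Q, and it has only nonnegative terms once A = 2 + A' and B = 2 + B'.
module Submission where

open import Defs
open import Data.Nat using (ℕ; suc; _≤_; _∸_; s≤s)
import Data.Nat as ℕ
open import Data.Nat.Properties using (m≤m+n)
import Data.Nat.Tactic.RingSolver as ℕ-Solver
open import Data.Integer using (+_; _-_; _*_; _+_)
open import Data.Integer.Properties using (pos-*; +-0-abelianGroup)
import Data.Integer.Tactic.RingSolver as ℤ-Solver
open import Algebra.Properties.AbelianGroup +-0-abelianGroup using (xyx⁻¹≈y)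
open import Data.List using (List; []; _∷_; _++_; reverse; foldl; [_])
open import Data.List.Properties using (foldl-++; unfold-reverse; reverse-++)
open import Data.List.Relation.Unary.All using (All)
open import Data.Product using (_×_; _,_; proj₁; proj₂)
open import Relation.Binary.PropositionalEquality
  using (_≡_; refl; sym; trans; cong; cong₂; subst; module ≡-Reasoning)

-- A state ((p , p₋) , (q , q₋)) is read as the 2×2 matrix [[p, p₋], [q, q₋]].
infixl 7 _⊗_
infix 30 _₁₁ _₁₂ _₂₁ _₂₂ _ᵀ

_₁₁ _₁₂ _₂₁ _₂₂ : ConvState → ℕ
S ₁₁ = proj₁ (proj₁ S)
S ₁₂ = proj₂ (proj₁ S)
S ₂₁ = proj₁ (proj₂ S)
S ₂₂ = proj₂ (proj₂ S)

_⊗_ : ConvState → ConvState → ConvState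
((a , b) , (c , d)) ⊗ ((e , f) , (g , h)) =
  ((a ℕ.* e ℕ.+ b ℕ.* g , a ℕ.* f ℕ.+ b ℕ.* h) , (c ℕ.* e ℕ.+ d ℕ.* g , c ℕ.* f ℕ.+ d ℕ.* h))

_ᵀ : ConvState → ConvState
((a , b) , (c , d)) ᵀ = ((a , c) , (b , d))

quotientMatrix : ℕ → ConvState
quotientMatrix x = ((x , 1) , (1 , 0))

matrix-≡ : ∀ {a b c d a' b' c' d' : ℕ} → a ≡ a' → b ≡ b' → c ≡ c' → d ≡ d' →
           ((a , b) , (c , d)) ≡ ((a' , b') , (c' , d'))
matrix-≡ refl refl refl refl = refl

⊗-assoc : ∀ S T U → S ⊗ T ⊗ U ≡ S ⊗ (T ⊗ U)
⊗-assoc ((a , b) , (c , d)) ((e , f) , (g , h)) ((x , y) , (z , w)) =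
  matrix-≡ (row·col a b x z) (row·col a b y w) (row·col c d x z) (row·col c d y w)
  where
  row·col : ∀ a b {e f g h} x z → (a ℕ.* e ℕ.+ b ℕ.* g) ℕ.* x ℕ.+ (a ℕ.* f ℕ.+ b ℕ.* h) ℕ.* z
                                  ≡ a ℕ.* (e ℕ.* x ℕ.+ f ℕ.* z) ℕ.+ b ℕ.* (g ℕ.* x ℕ.+ h ℕ.* z)
  row·col a b {e} {f} {g} {h} x z = ℕ-Solver.solve (a ∷ b ∷ e ∷ f ∷ g ∷ h ∷ x ∷ z ∷ [])

ᵀ-⊗ : ∀ S T → (S ⊗ T) ᵀ ≡ T ᵀ ⊗ S ᵀ
ᵀ-⊗ ((a , b) , (c , d)) ((e , f) , (g , h)) =
  matrix-≡ (dot-comm a b e g) (dot-comm c d e g) (dot-comm a b f h) (dot-comm c d f h)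
  where
  dot-comm : ∀ a b e g → a ℕ.* e ℕ.+ b ℕ.* g ≡ e ℕ.* a ℕ.+ g ℕ.* b
  dot-comm = ℕ-Solver.solve-∀

convStep-⊗ : ∀ S x → convStep S x ≡ S ⊗ quotientMatrix x
convStep-⊗ ((p , p₋) , (q , q₋)) x =
  matrix-≡ (new-entry p p₋) (old-entry p p₋) (new-entry q q₋) (old-entry q q₋)
  where
  new-entry : ∀ p p₋ → x ℕ.* p ℕ.+ p₋ ≡ p ℕ.* x ℕ.+ p₋ ℕ.* 1
  new-entry p p₋ = ℕ-Solver.solve (x ∷ p ∷ p₋ ∷ [])
  old-entry : ∀ p p₋ → p ≡ p ℕ.* 1 ℕ.+ p₋ ℕ.* 0
  old-entry = ℕ-Solver.solve-∀

conv-[x] : ∀ x → conv [ x ] ≡ quotientMatrix x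
conv-[x] x = matrix-≡ (ℕ-Solver.solve (x ∷ [])) refl (ℕ-Solver.solve (x ∷ [])) refl

foldl-convStep : ∀ S xs → foldl convStep S xs ≡ S ⊗ conv xs
foldl-convStep ((p , p₋) , (q , q₋)) [] =
  matrix-≡ (ℕ-Solver.solve (p ∷ p₋ ∷ [])) (ℕ-Solver.solve (p ∷ p₋ ∷ []))
           (ℕ-Solver.solve (q ∷ q₋ ∷ [])) (ℕ-Solver.solve (q ∷ q₋ ∷ []))
foldl-convStep S (x ∷ xs) = begin
  foldl convStep (convStep S x) xs   ≡⟨ foldl-convStep (convStep S x) xs ⟩
  convStep S x ⊗ conv xs             ≡⟨ cong (_⊗ conv xs) (convStep-⊗ S x) ⟩
  S ⊗ quotientMatrix x ⊗ conv xs     ≡⟨ ⊗-assoc S (quotientMatrix x) (conv xs) ⟩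
  S ⊗ (quotientMatrix x ⊗ conv xs)   ≡⟨ cong (λ T → S ⊗ (T ⊗ conv xs)) (conv-[x] x) ⟨
  S ⊗ (conv [ x ] ⊗ conv xs)         ≡⟨ cong (S ⊗_) (foldl-convStep (conv [ x ]) xs) ⟨
  S ⊗ conv (x ∷ xs)                  ∎
  where open ≡-Reasoning

conv-++ : ∀ xs ys → conv (xs ++ ys) ≡ conv xs ⊗ conv ys
conv-++ xs ys = trans (foldl-++ convStep convInit xs ys) (foldl-convStep (conv xs) ys)

conv-∷ : ∀ x xs → conv (x ∷ xs) ≡ quotientMatrix x ⊗ conv xs
conv-∷ x xs = trans (conv-++ [ x ] xs) (cong (_⊗ conv xs) (conv-[x] x))

conv-reverse : ∀ xs → conv (reverse xs) ≡ conv xs ᵀ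
conv-reverse [] = refl
conv-reverse (x ∷ xs) = begin
  conv (reverse (x ∷ xs))              ≡⟨ cong conv (unfold-reverse x xs) ⟩
  conv (reverse xs ++ [ x ])           ≡⟨ conv-++ (reverse xs) [ x ] ⟩
  conv (reverse xs) ⊗ conv [ x ]       ≡⟨ cong₂ _⊗_ (conv-reverse xs) (conv-[x] x) ⟩
  conv xs ᵀ ⊗ quotientMatrix x         ≡⟨ ᵀ-⊗ (quotientMatrix x) (conv xs) ⟨
  (quotientMatrix x ⊗ conv xs) ᵀ       ≡⟨ cong _ᵀ (conv-∷ x xs) ⟨
  conv (x ∷ xs) ᵀ                      ∎
  where open ≡-Reasoning

conv-++-transposed : ∀ ys b → conv (ys ++ b) ≡ foldl convStep (conv b ᵀ) (reverse ys) ᵀ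
-- Transposing twice is the identity up to η, so cong _ᵀ yields the statement itself.
conv-++-transposed ys b = cong _ᵀ (begin
  conv (ys ++ b) ᵀ                              ≡⟨ conv-reverse (ys ++ b) ⟨
  conv (reverse (ys ++ b))                      ≡⟨ cong conv (reverse-++ ys b) ⟩
  conv (reverse b ++ reverse ys)                ≡⟨ foldl-++ convStep convInit (reverse b) (reverse ys) ⟩
  foldl convStep (conv (reverse b)) (reverse ys) ≡⟨ cong (λ S → foldl convStep S (reverse ys)) (conv-reverse b) ⟩
  foldl convStep (conv b ᵀ) (reverse ys)        ∎)
  where open ≡-Reasoning

-- The quotients xs act on the rows of conv a and ys on the columns of conv b, both through
-- convStep, so that the entries of the right-hand side unfold to plain polynomials.
conv-sandwich : ∀ a xs m ys b →
  conv (a ++ (xs ++ m) ++ (ys ++ b))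
  ≡ foldl convStep (conv a) xs ⊗ (conv m ⊗ foldl convStep (conv b ᵀ) (reverse ys) ᵀ)
conv-sandwich a xs m ys b = begin
  conv (a ++ (xs ++ m) ++ (ys ++ b))             ≡⟨ conv-++ a ((xs ++ m) ++ (ys ++ b)) ⟩
  conv a ⊗ conv ((xs ++ m) ++ (ys ++ b))         ≡⟨ cong (conv a ⊗_) (conv-++ (xs ++ m) (ys ++ b)) ⟩
  conv a ⊗ (conv (xs ++ m) ⊗ conv (ys ++ b))     ≡⟨ cong (λ X → conv a ⊗ (X ⊗ conv (ys ++ b))) (conv-++ xs m) ⟩
  conv a ⊗ (conv xs ⊗ conv m ⊗ conv (ys ++ b))   ≡⟨ cong (conv a ⊗_) (⊗-assoc (conv xs) (conv m) (conv (ys ++ b))) ⟩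
  conv a ⊗ (conv xs ⊗ (conv m ⊗ conv (ys ++ b))) ≡⟨ ⊗-assoc (conv a) (conv xs) (conv m ⊗ conv (ys ++ b)) ⟨
  conv a ⊗ conv xs ⊗ (conv m ⊗ conv (ys ++ b))   ≡⟨ cong₂ (λ X Y → X ⊗ (conv m ⊗ Y))
                                                         (sym (foldl-convStep (conv a) xs)) (conv-++-transposed ys b) ⟩
  foldl convStep (conv a) xs ⊗ (conv m ⊗ foldl convStep (conv b ᵀ) (reverse ys) ᵀ) ∎
  where open ≡-Reasoning

-- The paper's gain with A = 2 + A' and B = 2 + B', so that AB - A - B = A'B' + A' + B'.
flipGain : ℕ → ℕ → ConvState → ConvState → ConvState → ℕ
flipGain A' B' P C Q =
  (C ₁₂ ℕ.+ C ₂₁ ℕ.+ C ₂₂) ℕ.*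
  (P ₁₁ ℕ.* Q ₁₁ ℕ.* (A' ℕ.* B' ℕ.+ A' ℕ.+ B') ℕ.+ P ₁₁ ℕ.* Q ₂₁ ℕ.* suc A'
   ℕ.+ P ₁₂ ℕ.* Q ₁₁ ℕ.* suc B' ℕ.+ P ₁₂ ℕ.* Q ₂₁)

numerator-flip : ∀ A' B' P C Q →
  (convStep (convStep P (suc A')) 1 ⊗ (C ᵀ ⊗ convStep (convStep (Q ᵀ) (suc B')) 1 ᵀ)) ₁₁
  ≡ (convStep P (2 ℕ.+ A') ⊗ (C ⊗ convStep (Q ᵀ) (2 ℕ.+ B') ᵀ)) ₁₁ ℕ.+ flipGain A' B' P C Q
numerator-flip A' B' ((p , p₋) , _) ((u , u₋) , (v , v₋)) ((r , _) , (s , _)) =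
  bilinear-identity A' B' p p₋ r s u u₋ v v₋
  where
  -- The flipped row is (x' + p , x') against (x' + p , p) before, and likewise for the
  -- columns; so each of the terms in u₋, v, v₋ grows by x' y' - p r, which is the gain.
  bilinear-identity : ∀ A' B' p p₋ r s u u₋ v v₋ →
    let x' = suc A' ℕ.* p ℕ.+ p₋
        y' = suc B' ℕ.* r ℕ.+ s
        x = suc (suc A') ℕ.* p ℕ.+ p₋
        y = suc (suc B') ℕ.* r ℕ.+ s
    in (1 ℕ.* x' ℕ.+ p) ℕ.* (u ℕ.* (1 ℕ.* y' ℕ.+ r) ℕ.+ v ℕ.* y')
       ℕ.+ x' ℕ.* (u₋ ℕ.* (1 ℕ.* y' ℕ.+ r) ℕ.+ v₋ ℕ.* y')
       ≡ x ℕ.* (u ℕ.* y ℕ.+ u₋ ℕ.* r) ℕ.+ p ℕ.* (v ℕ.* y ℕ.+ v₋ ℕ.* r)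
         ℕ.+ (u₋ ℕ.+ v ℕ.+ v₋) ℕ.* (p ℕ.* r ℕ.* (A' ℕ.* B' ℕ.+ A' ℕ.+ B') ℕ.+ p ℕ.* s ℕ.* suc A'
                                  ℕ.+ p₋ ℕ.* r ℕ.* suc B' ℕ.+ p₋ ℕ.* s)
  bilinear-identity = ℕ-Solver.solve-∀

𝒩-flip : ∀ A' B' a c b →
  𝒩 (a ++ (suc A' ∷ 1 ∷ reverse c) ++ (1 ∷ suc B' ∷ b))
  ≡ 𝒩 (a ++ (2 ℕ.+ A' ∷ c) ++ (2 ℕ.+ B' ∷ b)) ℕ.+ flipGain A' B' (conv a) (conv c) (conv b)
𝒩-flip A' B' a c b = begin
  𝒩 (a ++ (suc A' ∷ 1 ∷ reverse c) ++ (1 ∷ suc B' ∷ b))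
    ≡⟨ cong _₁₁ (conv-sandwich a (suc A' ∷ 1 ∷ []) (reverse c) (1 ∷ suc B' ∷ []) b) ⟩
  (R' ⊗ (conv (reverse c) ⊗ K' ᵀ)) ₁₁
    ≡⟨ cong (λ S → (R' ⊗ (S ⊗ K' ᵀ)) ₁₁) (conv-reverse c) ⟩
  (R' ⊗ (conv c ᵀ ⊗ K' ᵀ)) ₁₁
    ≡⟨ numerator-flip A' B' (conv a) (conv c) (conv b) ⟩
  (convStep (conv a) (2 ℕ.+ A') ⊗ (conv c ⊗ convStep (conv b ᵀ) (2 ℕ.+ B') ᵀ)) ₁₁ ℕ.+ G
    ≡⟨ cong (λ S → S ₁₁ ℕ.+ G) (conv-sandwich a [ 2 ℕ.+ A' ] c [ 2 ℕ.+ B' ] b) ⟨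
  𝒩 (a ++ (2 ℕ.+ A' ∷ c) ++ (2 ℕ.+ B' ∷ b)) ℕ.+ G ∎
  where
  open ≡-Reasoning
  R' = convStep (convStep (conv a) (suc A')) 1
  K' = convStep (convStep (conv b ᵀ) (suc B')) 1
  G = flipGain A' B' (conv a) (conv c) (conv b)

pos-flipGain : ∀ A' B' P C Q →
  let Az = + (2 ℕ.+ A')
      Bz = + (2 ℕ.+ B')
  in + flipGain A' B' P C Q ≡
     (+ C ₁₂ + + C ₂₁ + + C ₂₂)
     * (+ P ₁₁ * + Q ₁₁ * (Az * Bz - Az - Bz)
        + + P ₁₁ * + Q ₂₁ * (Az - + 1)
        + + P ₁₂ * + Q ₁₁ * (Bz - + 1)
        + + P ₁₂ * + Q ₂₁)
pos-flipGain A' B' ((p , p₋) , _) ((_ , u₋) , (v , v₋)) ((r , _) , (s , _)) =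
  trans (pos-* U D)
        (trans (cong (+ U *_) pos-D) (in-terms-of-A-B (+ U) (+ p) (+ p₋) (+ r) (+ s) (+ A') (+ B')))
  where
  U = u₋ ℕ.+ v ℕ.+ v₋
  D = p ℕ.* r ℕ.* (A' ℕ.* B' ℕ.+ A' ℕ.+ B') ℕ.+ p ℕ.* s ℕ.* suc A'
      ℕ.+ p₋ ℕ.* r ℕ.* suc B' ℕ.+ p₋ ℕ.* s

  pos-*₃ : ∀ a b c → + (a ℕ.* b ℕ.* c) ≡ + a * + b * + c
  pos-*₃ a b c = trans (pos-* (a ℕ.* b) c) (cong (_* + c) (pos-* a b))

  pos-D : + D ≡ + p * + r * (+ A' * + B' + + A' + + B') + + p * + s * (+ 1 + + A')
                + + p₋ * + r * (+ 1 + + B') + + p₋ * + s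
  pos-D = cong₂ _+_
    (cong₂ _+_
      (cong₂ _+_
        (trans (pos-*₃ p r (A' ℕ.* B' ℕ.+ A' ℕ.+ B'))
               (cong (λ w → + p * + r * (w + + A' + + B')) (pos-* A' B')))
        (pos-*₃ p s (suc A')))
      (pos-*₃ p₋ r (suc B')))
    (pos-* p₋ s)

  in-terms-of-A-B : ∀ u p p₋ r s a b →
    u * (p * r * (a * b + a + b) + p * s * (+ 1 + a) + p₋ * r * (+ 1 + b) + p₋ * s)
    ≡ u * (p * r * ((+ 2 + a) * (+ 2 + b) - (+ 2 + a) - (+ 2 + b)) + p * s * ((+ 2 + a) - + 1)
           + p₋ * r * ((+ 2 + b) - + 1) + p₋ * s)
  in-terms-of-A-B = ℤ-Solver.solve-∀

lemma3p1 : (A B : ℕ) → 2 ≤ A → 2 ≤ B →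
    (a₀ c₀ b₀ : ℕ) → (as cs bs : List ℕ) →
    All (1 ≤_) (a₀ ∷ as) → All (1 ≤_) (c₀ ∷ cs) → All (1 ≤_) (b₀ ∷ bs) →
    let a = a₀ ∷ as
        c = c₀ ∷ cs
        b = b₀ ∷ bs
        α = a ++ (A ∷ c) ++ (B ∷ b)
        α' = a ++ (A ∸ 1 ∷ 1 ∷ reverse c) ++ (1 ∷ B ∸ 1 ∷ b)
        Az = + A
        Bz = + B
    in (𝒩 α ≤ 𝒩 α')
       × ((+ 𝒩 α') - (+ 𝒩 α) ≡
          (+ pPrev c + + qLast c + + qPrev c)
          * (+ pLast a * + pLast b * (Az * Bz - Az - Bz)
             + + pLast a * + qLast b * (Az - + 1)
             + + pPrev a * + pLast b * (Bz - + 1)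
             + + pPrev a * + qLast b))
-- The identity is polynomial.
lemma3p1 (suc (suc A')) (suc (suc B')) (s≤s (s≤s _)) (s≤s (s≤s _)) a₀ c₀ b₀ as cs bs _ _ _ =
  subst (N ≤_) (sym N'≡N+G) (m≤m+n N G) ,
  (begin
    + N' - + N        ≡⟨ cong (λ n → + n - + N) N'≡N+G ⟩
    + N + + G - + N   ≡⟨ xyx⁻¹≈y (+ N) (+ G) ⟩
    + G               ≡⟨ pos-flipGain A' B' (conv a) (conv c) (conv b) ⟩
    _                 ∎)
  where
  open ≡-Reasoning
  a = a₀ ∷ as
  c = c₀ ∷ cs
  b = b₀ ∷ bs
  N = 𝒩 (a ++ (suc (suc A') ∷ c) ++ (suc (suc B') ∷ b))
  N' = 𝒩 (a ++ (suc A' ∷ 1 ∷ reverse c) ++ (1 ∷ suc B' ∷ b))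
  G = flipGain A' B' (conv a) (conv c) (conv b)
  N'≡N+G : N' ≡ N ℕ.+ G
  N'≡N+G = 𝒩-flip A' B' a c b
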